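{- Let $k,n,r$ be positive integers with $k \leq n$ and $r \leq k-1$. Define $\tau \colon [k]\times[n] \to [kn]$ by $\tau(x,y) = k\,\rho(y-x) + x$, where $\rho(y-x) \in \{0,1,\dots,n-1\}$ is the residue of $y-x$ modulo $n$. For $\phi \in S_k$ and $\psi \in S_n$ define $\tau_{\phi,\psi}\colon [k]\times[n]\to[kn]$ by $\tau_{\phi,\psi}(x,y) = \tau(\phi^{ -1}(x),\psi^{ -1}(y))$. Then for every $(\phi,\psi) \in S_k \times S_n$, the map $\tau_{\phi,\psi}$ is an $r$-good cyclic ordering of $[k]\times[n]$.
   Context: $S_m$ denotes the set of all bijections $[m]\to[m]$, where $[m]=\{1,\dots,m\}$. A cyclic ordering of a finite set $X$ with $|X|=m$ is a bijection $\sigma\colon X \to [m]$, regarded as arranging the elements of $X$ around a cycle. Elements $z_1,\dots,z_r$ of $X$ are numbered consecutively (in the cyclic sense) by $\sigma$ if, after reordering, $\sigma(z_{i+1}) \equiv \sigma(z_i)+1 \pmod m$ for each $i \in [r-1]$. A cyclic ordering $\sigma$ of $[k]\times[n]$ is $r$-good if for every set of $r$ elements $(x_1,y_1),\dots,(x_r,y_r)$ of $[k]\times[n]$ numbered consecutively in the cyclic sense by $\sigma$, the $x_1,\dots,x_r$ are distinct and the $y_1,\dots,y_r$ are distinct. -}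

module Defs where

open import Data.Nat using (ℕ; zero; suc; _+_; _*_; _∸_; _<_; _%_; NonZero)
open import Data.Fin using (Fin; toℕ)
open import Data.Fin.Permutation using (Permutation′; _⟨$⟩ˡ_)
open import Data.Product using (_×_; Σ; proj₁; proj₂)
open import Data.Sum using (_⊎_)
open import Relation.Binary.PropositionalEquality using (_≡_)
open import Relation.Nullary using (¬_)

-- Conventions: [k] is modelled by Fin k (element i stands for i+1), and
-- [m] = {1,…,m} is modelled by {0,…,m-1} ⊆ ℕ (value a stands for a+1).
-- These shifts are uniform, so they change neither the residue ρ(y-x)
-- nor the notion of cyclic consecutiveness.

IsCyclicOrdering : {X : Set} → (m : ℕ) → (X → ℕ) → Set
IsCyclicOrdering {X} m σ =
  (∀ z → σ z < m)
  × (∀ z w → σ z ≡ σ w → z ≡ w)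
  × (∀ a → a < m → Σ X (λ z → σ z ≡ a))

SuccMod : ℕ → ℕ → ℕ → Set
SuccMod m a b = (b ≡ suc a) ⊎ ((suc a ≡ m) × (b ≡ 0))

IsRGood : (k n r : ℕ) → (Fin k × Fin n → ℕ) → Set
IsRGood k n r σ =
  (z : Fin r → Fin k × Fin n) →
  (∀ i j → z i ≡ z j → i ≡ j) →
  (∀ (i j : Fin r) → toℕ j ≡ suc (toℕ i) → SuccMod (k * n) (σ (z i)) (σ (z j))) →
  (∀ i j → proj₁ (z i) ≡ proj₁ (z j) → i ≡ j)
  × (∀ i j → proj₂ (z i) ≡ proj₂ (z j) → i ≡ j)

-- ρ(y - x) ∈ {0,…,n-1}, the residue of y - x modulo n (x, y < n,
-- so (n + y) ∸ x is a natural number congruent to y - x)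
ρ : (n : ℕ) → .{{_ : NonZero n}} → ℕ → ℕ → ℕ
ρ n x y = ((n + y) ∸ x) % n

τ : (k n : ℕ) → .{{_ : NonZero n}} → Fin k → Fin n → ℕ
τ k n x y = k * ρ n (toℕ x) (toℕ y) + toℕ x

τφψ : (k n : ℕ) → .{{_ : NonZero n}} → Permutation′ k → Permutation′ n →
      Fin k × Fin n → ℕ
τφψ k n φ ψ p = τ k n (φ ⟨$⟩ˡ proj₁ p) (ψ ⟨$⟩ˡ proj₂ p)

-- Position a ∈ [kn] of τ is the pair x = a mod k, y = (x + ⌊a/k⌋) mod n, so τ is a
-- bijection. Consecutive positions are consecutive modulo kn, and k ∣ kn, so a window of
-- r < k of them has distinct residues modulo k: distinct x-coordinates. The unreduced
-- y-coordinate a mod k + ⌊a/k⌋ rises by one per step, except when a mod k wraps around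
-- (at most once in such a window), where it falls by k - 2. So two of its values in a window
-- differ by some d with 0 < d < k ≤ n or by k - 1 - d with 0 < k - 1 - d < n, never by a
-- multiple of n: distinct y-coordinates.
module Submission where

open import Defs
open import Data.Nat using (ℕ; _*_; _+_; _≤_; NonZero)
open import Data.Fin.Permutation using (Permutation′)
open import Data.Product using (_×_)

open import Data.Nat using (zero; suc; _∸_; _<_; _%_; _/_; _<?_; z<s)
open import Data.Nat.Properties
open import Data.Nat.DivMod
open import Algebra.Properties.CommutativeSemigroup +-commutativeSemigroup using (xy∙z≈xz∙y; xy∙z≈zx∙y)
open import Data.Nat.Divisibility using (_∣_; divides; >⇒∤; ∣m+n∣m⇒∣n; n∣m*n; m∣m*n; ∣-refl)
open import Data.Fin using (Fin; zero; suc; toℕ; fromℕ<; inject₁)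
open import Data.Fin.Properties using (toℕ-injective; toℕ<n; toℕ-fromℕ<; toℕ-inject₁)
open import Data.Fin.Permutation using (_⟨$⟩ˡ_; _⟨$⟩ʳ_; inverseˡ; inverseʳ)
open import Data.Product using (_,_; proj₁; proj₂; Σ)
open import Data.Sum using (_⊎_; inj₁; inj₂)
open import Function using (_∘_; case_of_)
open import Data.Empty using (⊥-elim)
open import Relation.Nullary using (yes; no)
open import Relation.Binary.PropositionalEquality
open ≡-Reasoning

private variable
  A : Set
  r : ℕ

InjectiveOnWindows : (ℕ → A) → ℕ → Set
InjectiveOnWindows f r = ∀ b {i j} → i < r → j < r → f (b + i) ≡ f (b + j) → i ≡ j

injectiveOnWindows : (f : ℕ → A) → (∀ b d → d < r → f (b + d) ≡ f b → d ≡ 0) →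
                     InjectiveOnWindows f r
injectiveOnWindows {r = r} f noRepeat b {i} {j} i<r j<r eq =
  case ≤-total i j of λ where
    (inj₁ i≤j) → ordered i≤j j<r eq
    (inj₂ j≤i) → sym (ordered j≤i i<r (sym eq))
  where
  ordered : ∀ {i j} → i ≤ j → j < r → f (b + i) ≡ f (b + j) → i ≡ j
  ordered {i} {j} i≤j j<r eq = begin
    i              ≡⟨ +-identityʳ i ⟨
    i + 0          ≡⟨ cong (i +_) d≡0 ⟨
    i + (j ∸ i)    ≡⟨ m+[n∸m]≡n i≤j ⟩
    j              ∎
    where
    d≡0 : j ∸ i ≡ 0
    d≡0 = noRepeat (b + i) (j ∸ i) (≤-<-trans (m∸n≤m j i) j<r)
            (trans (cong f (trans (+-assoc b i _) (cong (b +_) (m+[n∸m]≡n i≤j)))) (sym eq))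

[m+o]%n≡m%n⇒o≡0 : ∀ m {n o} .{{_ : NonZero n}} → o < n → (m + o) % n ≡ m % n → o ≡ 0
[m+o]%n≡m%n⇒o≡0 m {o = zero}  _   _  = refl
[m+o]%n≡m%n⇒o≡0 m {n} {o@(suc _)} o<n eq = ⊥-elim (>⇒∤ o<n n∣o)
  where
  multiple : m / n * n + o ≡ (m + o) / n * n
  multiple = +-cancelˡ-≡ (m % n) _ _ (begin
    m % n + (m / n * n + o)   ≡⟨ +-assoc (m % n) _ o ⟨
    m % n + m / n * n + o     ≡⟨ cong (_+ o) (m≡m%n+[m/n]*n m n) ⟨
    m + o                     ≡⟨ m≡m%n+[m/n]*n (m + o) n ⟩
    (m + o) % n + (m + o) / n * n ≡⟨ cong (_+ (m + o) / n * n) eq ⟩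
    m % n + (m + o) / n * n   ∎)
  n∣o : n ∣ o
  n∣o = ∣m+n∣m⇒∣n (divides ((m + o) / n) multiple) (n∣m*n (m / n))

%-injectiveOnWindows : ∀ n .{{_ : NonZero n}} → InjectiveOnWindows (_% n) n
%-injectiveOnWindows n = injectiveOnWindows (_% n) (λ b d → [m+o]%n≡m%n⇒o≡0 b)

[m+n%d]%d≡[m+n]%d : ∀ m n d .{{_ : NonZero d}} → (m + n % d) % d ≡ (m + n) % d
[m+n%d]%d≡[m+n]%d m n d = begin
  (m + n % d) % d             ≡⟨ %-distribˡ-+ m (n % d) d ⟩
  (m % d + n % d % d) % d     ≡⟨ cong (λ c → (m % d + c) % d) (m%n%n≡m%n n d) ⟩
  (m % d + n % d) % d         ≡⟨ %-distribˡ-+ m n d ⟨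
  (m + n) % d                 ∎

[k*q+s]%k≡s : ∀ k q {s} .{{_ : NonZero k}} → s < k → (k * q + s) % k ≡ s
[k*q+s]%k≡s k q {s} s<k = trans (%-remove-+ˡ s (m∣m*n q)) (m<n⇒m%n≡m s<k)

[k*q+s]/k≡q : ∀ k q {s} .{{_ : NonZero k}} → s < k → (k * q + s) / k ≡ q
[k*q+s]/k≡q k q {s} s<k = begin
  (k * q + s) / k     ≡⟨ +-distrib-/-∣ˡ s (m∣m*n q) ⟩
  k * q / k + s / k   ≡⟨ cong₂ _+_ (trans (/-congˡ (*-comm k q)) (m*n/n≡m q k)) (m<n⇒m/n≡0 s<k) ⟩
  q + 0               ≡⟨ +-identityʳ q ⟩
  q                   ∎

k*[m/k]+m%k≡m : ∀ m k .{{_ : NonZero k}} → k * (m / k) + m % k ≡ m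
k*[m/k]+m%k≡m m k = begin
  k * (m / k) + m % k   ≡⟨ +-comm _ (m % k) ⟩
  m % k + k * (m / k)   ≡⟨ cong (m % k +_) (*-comm k (m / k)) ⟩
  m % k + m / k * k     ≡⟨ m≡m%n+[m/n]*n m k ⟨
  m                     ∎

SuccMod⇒≡suc% : ∀ {m a b} .{{_ : NonZero m}} → b < m → SuccMod m a b → b ≡ suc a % m
SuccMod⇒≡suc%     b<m (inj₁ refl)           = sym (m<n⇒m%n≡m b<m)
SuccMod⇒≡suc% {m} _   (inj₂ (1+a≡m , refl)) = sym (trans (%-congˡ 1+a≡m) (n%n≡0 m))

SuccMod-chain⇒≡[s₀+i]% : ∀ {m r} .{{_ : NonZero m}} (s : Fin (suc r) → ℕ) → (∀ i → s i < m) →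
  (∀ i j → toℕ j ≡ suc (toℕ i) → SuccMod m (s i) (s j)) → ∀ i → s i ≡ (s zero + toℕ i) % m
SuccMod-chain⇒≡[s₀+i]% s bounded succ zero =
  sym (trans (%-congˡ (+-identityʳ (s zero))) (m<n⇒m%n≡m (bounded zero)))
SuccMod-chain⇒≡[s₀+i]% {m} {suc r} s bounded succ (suc i) = begin
  s (suc i)                       ≡⟨ SuccMod⇒≡suc% (bounded (suc i)) (succ (inject₁ i) (suc i) i→1+i) ⟩
  suc (s (inject₁ i)) % m         ≡⟨ cong (λ c → suc c % m) previous ⟩
  suc ((s zero + toℕ i) % m) % m  ≡⟨ [m+n%d]%d≡[m+n]%d 1 (s zero + toℕ i) m ⟩
  suc (s zero + toℕ i) % m        ≡⟨ %-congˡ (+-suc (s zero) (toℕ i)) ⟨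
  (s zero + suc (toℕ i)) % m      ∎
  where
  i→1+i : toℕ (suc i) ≡ suc (toℕ (inject₁ i))
  i→1+i = cong suc (sym (toℕ-inject₁ i))
  succ′ : ∀ i j → toℕ j ≡ suc (toℕ i) → SuccMod m (s (inject₁ i)) (s (inject₁ j))
  succ′ i j e = succ (inject₁ i) (inject₁ j) (trans (toℕ-inject₁ j) (trans e (cong suc (sym (toℕ-inject₁ i)))))
  previous : s (inject₁ i) ≡ (s zero + toℕ i) % m
  previous = SuccMod-chain⇒≡[s₀+i]% (s ∘ inject₁) (bounded ∘ inject₁) succ′ i

diagonal : (k : ℕ) .{{_ : NonZero k}} → ℕ → ℕ
diagonal k a = a % k + a / k

diagonal-k*q+s : ∀ k q {s} .{{_ : NonZero k}} → s < k → diagonal k (k * q + s) ≡ s + q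
diagonal-k*q+s k q s<k = cong₂ _+_ ([k*q+s]%k≡s k q s<k) ([k*q+s]/k≡q k q s<k)

-- The second case is the step across a multiple of k, where a mod k wraps around.
diagonal-+ : ∀ k b d .{{_ : NonZero k}} → d < k →
  diagonal k (b + d) ≡ diagonal k b + d ⊎ diagonal k (b + d) + k ≡ diagonal k b + suc d
diagonal-+ k b d d<k = case s + d <? k of λ where
    (yes s+d<k) → inj₁ (begin
      diagonal k (b + d)            ≡⟨ cong (diagonal k) b+d≡k*q+[s+d] ⟩
      diagonal k (k * q + (s + d))  ≡⟨ diagonal-k*q+s k q s+d<k ⟩
      s + d + q                     ≡⟨ xy∙z≈xz∙y s d q ⟩
      s + q + d                     ∎)
    (no s+d≮k) → inj₂ (wrapped (≮⇒≥ s+d≮k))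
  where
  s q : ℕ
  s = b % k
  q = b / k
  b+d≡k*q+[s+d] : b + d ≡ k * q + (s + d)
  b+d≡k*q+[s+d] = trans (cong (_+ d) (sym (k*[m/k]+m%k≡m b k))) (+-assoc (k * q) s d)
  wrapped : k ≤ s + d → diagonal k (b + d) + k ≡ s + q + suc d
  wrapped k≤s+d = begin
    diagonal k (b + d) + k        ≡⟨ cong (λ c → diagonal k c + k) b+d≡k*[1+q]+t ⟩
    diagonal k (k * suc q + t) + k ≡⟨ cong (_+ k) (diagonal-k*q+s k (suc q) t<k) ⟩
    t + suc q + k                 ≡⟨ xy∙z≈zx∙y t (suc q) k ⟩
    k + t + suc q                 ≡⟨ cong (_+ suc q) s+d≡k+t ⟨
    s + d + suc q                 ≡⟨ xy∙z≈xz∙y s d (suc q) ⟩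
    s + suc q + d                 ≡⟨ cong (_+ d) (+-suc s q) ⟩
    suc (s + q + d)               ≡⟨ +-suc (s + q) d ⟨
    s + q + suc d                 ∎
    where
    t : ℕ
    t = s + d ∸ k
    s+d≡k+t : s + d ≡ k + t
    s+d≡k+t = sym (m+[n∸m]≡n k≤s+d)
    t<k : t < k
    t<k = +-cancelˡ-< k t k (subst (_< k + k) s+d≡k+t (+-mono-< (m%n<n b k) d<k))
    b+d≡k*[1+q]+t : b + d ≡ k * suc q + t
    b+d≡k*[1+q]+t = begin
      b + d               ≡⟨ b+d≡k*q+[s+d] ⟩
      k * q + (s + d)     ≡⟨ cong (k * q +_) s+d≡k+t ⟩
      k * q + (k + t)     ≡⟨ +-assoc (k * q) k t ⟨
      k * q + k + t       ≡⟨ cong (_+ t) (trans (+-comm (k * q) k) (sym (*-suc k q))) ⟩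
      k * suc q + t       ∎

ycoord : (k n : ℕ) .{{_ : NonZero k}} .{{_ : NonZero n}} → ℕ → ℕ
ycoord k n a = diagonal k a % n

ycoord-injectiveOnWindows : ∀ k n {r} .{{_ : NonZero k}} .{{_ : NonZero n}} → r < k → k ≤ n →
                            InjectiveOnWindows (ycoord k n) r
ycoord-injectiveOnWindows k n {r} r<k k≤n = injectiveOnWindows (ycoord k n) noRepeat
  where
  noRepeat : ∀ b d → d < r → ycoord k n (b + d) ≡ ycoord k n b → d ≡ 0
  noRepeat b d d<r eq = case diagonal-+ k b d (<-trans d<r r<k) of λ where
      (inj₁ advanced) → [m+o]%n≡m%n⇒o≡0 (diagonal k b) (<-≤-trans (<-trans d<r r<k) k≤n)
                          (trans (cong (_% n) (sym advanced)) eq)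
      (inj₂ wrapped)  → ⊥-elim (<⇒≢ (m<n⇒0<n∸m 1+d<k) (sym (e≡0 wrapped)))
    where
    1+d<k : suc d < k
    1+d<k = ≤-<-trans d<r r<k
    e : ℕ
    e = k ∸ suc d
    e+1+d≡k : e + suc d ≡ k
    e+1+d≡k = m∸n+n≡m (<⇒≤ 1+d<k)
    e<n : e < n
    e<n = <-≤-trans (subst (e <_) e+1+d≡k (m<m+n e z<s)) k≤n
    e≡0 : diagonal k (b + d) + k ≡ diagonal k b + suc d → e ≡ 0
    e≡0 wrapped = [m+o]%n≡m%n⇒o≡0 (diagonal k (b + d)) e<n (trans (cong (_% n) dropped) (sym eq))
      where
      dropped : diagonal k (b + d) + e ≡ diagonal k b
      dropped = +-cancelʳ-≡ (suc d) _ _ (begin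
        diagonal k (b + d) + e + suc d    ≡⟨ +-assoc (diagonal k (b + d)) e (suc d) ⟩
        diagonal k (b + d) + (e + suc d)  ≡⟨ cong (diagonal k (b + d) +_) e+1+d≡k ⟩
        diagonal k (b + d) + k            ≡⟨ wrapped ⟩
        diagonal k b + suc d              ∎)

[x+ρ]%n≡y : ∀ n {x y} .{{_ : NonZero n}} → x ≤ n → y < n → (x + ρ n x y) % n ≡ y
[x+ρ]%n≡y n {x} {y} x≤n y<n = begin
  (x + (n + y ∸ x) % n) % n   ≡⟨ [m+n%d]%d≡[m+n]%d x (n + y ∸ x) n ⟩
  (x + (n + y ∸ x)) % n       ≡⟨ %-congˡ (m+[n∸m]≡n (≤-trans x≤n (m≤m+n n y))) ⟩
  (n + y) % n                 ≡⟨ %-remove-+ˡ y ∣-refl ⟩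
  y % n                       ≡⟨ m<n⇒m%n≡m y<n ⟩
  y                           ∎

⟨$⟩ˡ-injective : ∀ {m} (π : Permutation′ m) {i j} → toℕ (π ⟨$⟩ˡ i) ≡ toℕ (π ⟨$⟩ˡ j) → i ≡ j
⟨$⟩ˡ-injective π {i} {j} eq = begin
  i                      ≡⟨ inverseʳ π ⟨
  π ⟨$⟩ʳ (π ⟨$⟩ˡ i)       ≡⟨ cong (π ⟨$⟩ʳ_) (toℕ-injective eq) ⟩
  π ⟨$⟩ʳ (π ⟨$⟩ˡ j)       ≡⟨ inverseʳ π ⟩
  j                      ∎

module _ {k n : ℕ} .{{_ : NonZero k}} .{{_ : NonZero n}} where

  private instance
    k*n≢0 : NonZero (k * n)
    k*n≢0 = m*n≢0 k n

  ycoord-%[k*n] : ∀ a → ycoord k n (a % (k * n)) ≡ ycoord k n a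
  ycoord-%[k*n] a = begin
    (a % (k * n) % k + a % (k * n) / k) % n  ≡⟨ cong₂ (λ x y → (x + y) % n) remainder quotient ⟩
    (a % k + a / k % n) % n                  ≡⟨ [m+n%d]%d≡[m+n]%d (a % k) (a / k) n ⟩
    (a % k + a / k) % n                      ∎
    where
    instance
      n*k≢0 : NonZero (n * k)
      n*k≢0 = m*n≢0 n k
    remainder : a % (k * n) % k ≡ a % k
    remainder = m∣n⇒o%n%m≡o%m k (k * n) a (m∣m*n n)
    quotient : a % (k * n) / k ≡ a / k % n
    quotient = trans (/-congˡ (%-congʳ (*-comm k n))) (m%[n*o]/o≡m/o%n a n k)

  τ%k≡x : ∀ x y → τ k n x y % k ≡ toℕ x
  τ%k≡x x y = [k*q+s]%k≡s k _ (toℕ<n x)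

  τ/k≡ρ : ∀ x y → τ k n x y / k ≡ ρ n (toℕ x) (toℕ y)
  τ/k≡ρ x y = [k*q+s]/k≡q k _ (toℕ<n x)

  τ<k*n : ∀ x y → τ k n x y < k * n
  τ<k*n x y = <-≤-trans (+-monoʳ-< (k * ρ′) (toℕ<n x))
                        (subst (_≤ k * n) (trans (*-suc k ρ′) (+-comm k (k * ρ′))) (*-monoʳ-≤ k (m%n<n _ n)))
    where
    ρ′ : ℕ
    ρ′ = ρ n (toℕ x) (toℕ y)

  module _ (k≤n : k ≤ n) where

    ycoord-τ : ∀ x y → ycoord k n (τ k n x y) ≡ toℕ y
    ycoord-τ x y = trans (cong₂ (λ u v → (u + v) % n) (τ%k≡x x y) (τ/k≡ρ x y))
                      ([x+ρ]%n≡y n (≤-trans (<⇒≤ (toℕ<n x)) k≤n) (toℕ<n y))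

    τ-injective : ∀ {x y x′ y′} → τ k n x y ≡ τ k n x′ y′ → x ≡ x′ × y ≡ y′
    τ-injective {x} {y} {x′} {y′} eq =
        toℕ-injective (trans (sym (τ%k≡x x y)) (trans (%-congˡ eq) (τ%k≡x x′ y′)))
      , toℕ-injective (trans (sym (ycoord-τ x y)) (trans (cong (ycoord k n) eq) (ycoord-τ x′ y′)))

    τ-surjective : ∀ {a} → a < k * n → Σ (Fin k × Fin n) (λ (x , y) → τ k n x y ≡ a)
    τ-surjective {a} a<k*n = (x , y) , (begin
      k * ρ n (toℕ x) (toℕ y) + toℕ x   ≡⟨ cong₂ (λ u v → k * ρ n u v + u) (toℕ-fromℕ< _) (toℕ-fromℕ< _) ⟩
      k * ρ n (a % k) (ycoord k n a) + a % k ≡⟨ cong (λ c → k * c + a % k) ρ≡a/k ⟩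
      k * (a / k) + a % k               ≡⟨ k*[m/k]+m%k≡m a k ⟩
      a                                 ∎)
      where
      x : Fin k
      x = fromℕ< (m%n<n a k)
      y : Fin n
      y = fromℕ< (m%n<n (diagonal k a) n)
      ρ≡a/k : ρ n (a % k) (ycoord k n a) ≡ a / k
      ρ≡a/k = %-injectiveOnWindows n (a % k) (m%n<n _ n) (m<n*o⇒m/o<n (subst (a <_) (*-comm k n) a<k*n))
                ([x+ρ]%n≡y n (≤-trans (<⇒≤ (m%n<n a k)) k≤n) (m%n<n _ n))

    module _ (φ : Permutation′ k) (ψ : Permutation′ n) where

      τφψ-isCyclicOrdering : IsCyclicOrdering (k * n) (τφψ k n φ ψ)
      τφψ-isCyclicOrdering = (λ _ → τ<k*n _ _) , injective , surjective
        where
        injective : ∀ p q → τφψ k n φ ψ p ≡ τφψ k n φ ψ q → p ≡ q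
        injective _ _ eq = let (x≡x′ , y≡y′) = τ-injective eq in
          cong₂ _,_ (⟨$⟩ˡ-injective φ (cong toℕ x≡x′)) (⟨$⟩ˡ-injective ψ (cong toℕ y≡y′))
        surjective : ∀ a → a < k * n → Σ (Fin k × Fin n) (λ p → τφψ k n φ ψ p ≡ a)
        surjective a a<k*n = let ((x , y) , τxy≡a) = τ-surjective a<k*n in
          (φ ⟨$⟩ʳ x , ψ ⟨$⟩ʳ y) , trans (cong₂ (τ k n) (inverseˡ φ) (inverseˡ ψ)) τxy≡a

      τφψ-isRGood : ∀ {r} → r < k → IsRGood k n r (τφψ k n φ ψ)
      τφψ-isRGood {zero}  _   z _ _ = (λ ()) , (λ ())
      τφψ-isRGood {suc r} r<k z _ successive = xs-distinct , ys-distinct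
        where
        σ : Fin k × Fin n → ℕ
        σ = τφψ k n φ ψ
        a₀ : ℕ
        a₀ = σ (z zero)
        position : ∀ i → σ (z i) ≡ (a₀ + toℕ i) % (k * n)
        position = SuccMod-chain⇒≡[s₀+i]% (σ ∘ z) (λ _ → τ<k*n _ _) successive
        x-of : ∀ i → toℕ (φ ⟨$⟩ˡ proj₁ (z i)) ≡ (a₀ + toℕ i) % k
        x-of i = begin
          toℕ (φ ⟨$⟩ˡ proj₁ (z i))     ≡⟨ τ%k≡x _ _ ⟨
          σ (z i) % k                  ≡⟨ %-congˡ (position i) ⟩
          (a₀ + toℕ i) % (k * n) % k   ≡⟨ m∣n⇒o%n%m≡o%m k (k * n) _ (m∣m*n n) ⟩
          (a₀ + toℕ i) % k             ∎
        y-of : ∀ i → toℕ (ψ ⟨$⟩ˡ proj₂ (z i)) ≡ ycoord k n (a₀ + toℕ i)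
        y-of i = begin
          toℕ (ψ ⟨$⟩ˡ proj₂ (z i))            ≡⟨ ycoord-τ _ _ ⟨
          ycoord k n (σ (z i))                ≡⟨ cong (ycoord k n) (position i) ⟩
          ycoord k n ((a₀ + toℕ i) % (k * n)) ≡⟨ ycoord-%[k*n] _ ⟩
          ycoord k n (a₀ + toℕ i)             ∎
        xs-distinct : ∀ i j → proj₁ (z i) ≡ proj₁ (z j) → i ≡ j
        xs-distinct i j eq = toℕ-injective
          (%-injectiveOnWindows k a₀ (<-trans (toℕ<n i) r<k) (<-trans (toℕ<n j) r<k)
            (trans (sym (x-of i)) (trans (cong (λ c → toℕ (φ ⟨$⟩ˡ c)) eq) (x-of j))))
        ys-distinct : ∀ i j → proj₂ (z i) ≡ proj₂ (z j) → i ≡ j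
        ys-distinct i j eq = toℕ-injective
          (ycoord-injectiveOnWindows k n r<k k≤n a₀ (toℕ<n i) (toℕ<n j)
            (trans (sym (y-of i)) (trans (cong (λ c → toℕ (ψ ⟨$⟩ˡ c)) eq) (y-of j))))

lemma5 : (k n r : ℕ) → .{{_ : NonZero n}} → 1 ≤ k → 1 ≤ r → k ≤ n → r + 1 ≤ k →
    (φ : Permutation′ k) (ψ : Permutation′ n) →
    IsCyclicOrdering (k * n) (τφψ k n φ ψ) × IsRGood k n r (τφψ k n φ ψ)
lemma5 k@(suc _) n r _ _ k≤n r+1≤k φ ψ =
  τφψ-isCyclicOrdering k≤n φ ψ , τφψ-isRGood k≤n φ ψ (subst (_≤ k) (+-comm r 1) r+1≤k)
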